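{- Let $d\ge 1$ and $k_1,\dots,k_d\ge 1$ be integers and let $f$ be the function on $n=2\sum_{i=1}^d k_i$ variables defined in the context. Then $\deg_{\pm}(f)\le d$.
   Context: Boolean functions are maps $\{0,1\}^n\to\{0,1\}$; $\mathrm{sgn}(t)=1$ if $t\ge 0$ and $\mathrm{sgn}(t)=0$ otherwise. A threshold gate for $f$ is an integer-coefficient polynomial $p$ with $f(x)=\mathrm{sgn}(p(x))$ for all $x\in\{0,1\}^n$; $\deg_{\pm}(f)$ is the minimal degree of a threshold gate for $f$. The function $f$: the input is $(x^1,\dots,x^d,y^1,\dots,y^d)$ with $x^i=(x^i_1,\dots,x^i_{k_i}),\ y^i=(y^i_1,\dots,y^i_{k_i})\in\{0,1\}^{k_i}$. For a positive integer $k$ and $[k]=\{1,\dots,k\}$, let $<_1$ be the order $1,2,\dots,k$ and $<_0$ the reverse order $k,k-1,\dots,1$ (listed from smallest to largest); let $\mathrm{num}_1(j)=j$ and $\mathrm{num}_0(j)=k-j+1$ be the position of $j$ in these orders. Let $K=[k_1]\times\dots\times[k_d]$. To each $\alpha=(\alpha_1,\dots,\alpha_d)\in K$ associate indices $i_1(\alpha)=1$ and $i_{l+1}(\alpha)=\mathrm{num}_{i_l(\alpha)}(\alpha_l)\bmod 2$ (computed in $[k_l]$). Order $K$ as follows: for $\alpha\ne\beta$ let $l$ be the least index with $\alpha_l\ne\beta_l$ (then $i_l(\alpha)=i_l(\beta)$); declare $\alpha<\beta$ iff $\alpha_l$ precedes $\beta_l$ in the order $<_{i_l(\alpha)}$ on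 $[k_l]$. Let $\alpha$ be the largest element of $K$ in this order with $\prod_{i=1}^d(x^i_{\alpha_i}-y^i_{\alpha_i})\ne 0$; then $f(x,y)=\mathrm{sgn}\prod_{i=1}^d(x^i_{\alpha_i}-y^i_{\alpha_i})$. If no such $\alpha$ exists, $f(x,y)=1$. -}

module Defs where

open import Data.Nat as ℕ using (ℕ; zero; suc; _∸_; _<?_)
open import Data.Nat.DivMod using (_%_)
open import Data.Fin using (Fin; toℕ; fromℕ<)
open import Data.Bool using (Bool; true; false; if_then_else_)
open import Data.Integer as ℤ using (ℤ; 0ℤ; 1ℤ; _≤?_)
open import Data.List using (List; []; _∷_; length)
open import Data.List.Relation.Unary.All using (All)
open import Data.Product using (Σ; _×_; _,_; ∃)
open import Data.Sum using (_⊎_)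
open import Relation.Binary.PropositionalEquality using (_≡_; _≢_)
open import Relation.Nullary using (¬_; yes; no)
open import Relation.Nullary.Decidable using (does)

sgn : ℤ → Bool
sgn t = does (0ℤ ≤? t)

val : Bool → ℤ
val true  = 1ℤ
val false = 0ℤ

record Term (V : Set) : Set where
  constructor term
  field
    coeff : ℤ
    mono  : List V
open Term public

Poly : Set → Set
Poly V = List (Term V)

evalMono : {V : Set} → (V → Bool) → List V → ℤ
evalMono a []       = 1ℤ
evalMono a (v ∷ vs) = val (a v) ℤ.* evalMono a vs

eval : {V : Set} → Poly V → (V → Bool) → ℤ
eval []       a = 0ℤ
eval (t ∷ ts) a = coeff t ℤ.* evalMono a (mono t) ℤ.+ eval ts a

DegLe : {V : Set} → Poly V → ℕ → Set
DegLe p D = All (λ t → length (mono t) ℕ.≤ D) p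

module _ (d : ℕ) (k : Fin d → ℕ) where

  -- variables: (true , i , j) is x^i_j, (false , i , j) is y^i_j
  Var : Set
  Var = Bool × Σ (Fin d) (λ i → Fin (k i))

  -- elements of K = [k₁] × … × [k_d]  (coordinate j ∈ Fin (k i) stands for j+1)
  K : Set
  K = (i : Fin d) → Fin (k i)

  prodFin : (n : ℕ) → (Fin n → ℤ) → ℤ
  prodFin zero    g = 1ℤ
  prodFin (suc n) g = g Fin.zero ℤ.* prodFin n (λ i → g (Fin.suc i))

  prodα : (Var → Bool) → K → ℤ
  prodα z α = prodFin d (λ i → val (z (true , i , α i)) ℤ.- val (z (false , i , α i)))

  -- (α_l as an element of [k_l], k_l) for l < d
  coord : K → ℕ → ℕ × ℕ
  coord α m with m <? d
  ... | yes m<d = (suc (toℕ (α (fromℕ< m<d))) , k (fromℕ< m<d))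
  ... | no  _   = (0 , 0)

  num : Bool → ℕ × ℕ → ℕ
  num true  (j , kk) = j
  num false (j , kk) = suc (kk ∸ j)

  parity : ℕ → Bool
  parity n with n % 2
  ... | zero  = false
  ... | suc _ = true

  -- i_{m+1}(α) (0-based m); true means index 1, false means index 0
  ind : K → ℕ → Bool
  ind α zero    = true
  ind α (suc m) = parity (num (ind α m) (coord α m))

  Precedes : {kk : ℕ} → Bool → Fin kk → Fin kk → Set
  Precedes true  a b = toℕ a ℕ.< toℕ b
  Precedes false a b = toℕ b ℕ.< toℕ a

  _<K_ : K → K → Set
  α <K β = ∃ λ (l : Fin d) →
             (∀ (m : Fin d) → toℕ m ℕ.< toℕ l → α m ≡ β m)
           × Precedes (ind α (toℕ l)) (α l) (β l)

  -- f(x,y) ≡ b, following the definition: the largest α ∈ K with nonzero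
  -- product determines the value; if there is none the value is 1.
  FValue : (Var → Bool) → Bool → Set
  FValue z b =
      (Σ K λ α → prodα z α ≢ 0ℤ
               × (∀ β → α <K β → prodα z β ≡ 0ℤ)
               × b ≡ sgn (prodα z α))
    ⊎ ((∀ α → prodα z α ≡ 0ℤ) × b ≡ true)

module Submission where

-- For α ∈ K put v(α) = ∏ᵢ (x^i_{α_i} − y^i_{α_i}), an integer in {−1, 0, 1}.
-- List K in increasing order α₀ < α₁ < … < α_N and take
--     p = v(α₀) + 2 v(α₁) + 4 v(α₂) + … + 2^N v(α_N).
-- Every v(α) expands into a polynomial whose monomials have d variables, so
-- deg p ≤ d.  Since |v(α)| ≤ 1, the last nonzero summand dominates the sum
-- of all earlier ones: sgn p = sgn v(α) for the largest α with v(α) ≠ 0, and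
-- p = 0 when v vanishes everywhere.  This is exactly the definition of f.

open import Defs
open import Data.Nat as ℕ using (ℕ; zero; suc; _≤_; _≥_; _<?_)
import Data.Nat.Properties as ℕP
open import Data.Fin as Fin using (Fin; toℕ; fromℕ<)
import Data.Fin.Properties as FinP
open import Data.Integer as ℤ using (ℤ; 0ℤ; 1ℤ; -1ℤ; +_; -[1+_]; +[1+_])
import Data.Integer.Properties as ℤP
open import Data.Integer.Tactic.RingSolver using (solve-∀)
open import Data.Bool using (Bool; true; false)
open import Data.List using (List; []; _∷_; _++_; map; concatMap; allFin)
open import Data.List.Relation.Unary.All as All using (All; []; _∷_)
import Data.List.Relation.Unary.All.Properties as AllP
open import Data.List.Relation.Unary.AllPairs as AllPairs using (AllPairs; []; _∷_)
open import Data.List.Relation.Unary.Any as Any using (here; there)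
open import Data.List.Relation.Unary.Linked.Properties using (Linked⇒AllPairs)
open import Data.List.Membership.Propositional using (_∈_)
open import Data.List.Membership.Propositional.Properties using (∈-allFin; ∈-map⁺; ∈-concatMap⁺)
open import Data.List.Relation.Binary.Permutation.Propositional using (↭-sym)
open import Data.List.Relation.Binary.Permutation.Propositional.Properties using (∈-resp-↭)
open import Data.Product using (Σ; _×_; _,_; proj₁; proj₂)
open import Data.Sum using (_⊎_; inj₁; inj₂)
open import Data.Empty using (⊥-elim)
open import Function using (_∘_)
open import Level using (0ℓ)
open import Relation.Nullary using (¬_; yes; no)
open import Relation.Binary using (Rel; IsEquivalence; StrictTotalOrder;
  Irreflexive; Transitive; Trichotomous; _Respectsʳ_; _Respectsˡ_; tri<; tri≈; tri>)
open import Relation.Binary.PropositionalEquality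

Trit : ℤ → Set
Trit t = t ≡ 0ℤ ⊎ t ≡ 1ℤ ⊎ t ≡ -1ℤ

bitDiff-trit : ∀ a b → Trit (val a ℤ.- val b)
bitDiff-trit true  true  = inj₁ refl
bitDiff-trit true  false = inj₂ (inj₁ refl)
bitDiff-trit false true  = inj₂ (inj₂ refl)
bitDiff-trit false false = inj₁ refl

trit-* : ∀ {s t} → Trit s → Trit t → Trit (s ℤ.* t)
trit-* (inj₁ refl)        _                  = inj₁ refl
trit-* {t = t} (inj₂ (inj₁ refl)) t-trit rewrite ℤP.*-identityˡ t = t-trit
trit-* (inj₂ (inj₂ refl)) (inj₁ refl)        = inj₁ refl
trit-* (inj₂ (inj₂ refl)) (inj₂ (inj₁ refl)) = inj₂ (inj₂ refl)
trit-* (inj₂ (inj₂ refl)) (inj₂ (inj₂ refl)) = inj₂ (inj₁ refl)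

-- Dominance step: a trit added to a nonzero even number 2h changes neither
-- its non-vanishing nor its sign, because |2h| ≥ 2 > |t|.
trit-+-double : ∀ {t} h → Trit t → h ≢ 0ℤ →
                t ℤ.+ (h ℤ.+ h) ≢ 0ℤ × sgn (t ℤ.+ (h ℤ.+ h)) ≡ sgn h
trit-+-double (+ zero)  _                  h≢0 = ⊥-elim (h≢0 refl)
trit-+-double +[1+ n ] (inj₁ refl)        _   = (λ ()) , refl
trit-+-double +[1+ n ] (inj₂ (inj₁ refl)) _   = (λ ()) , refl
trit-+-double +[1+ n ] (inj₂ (inj₂ refl)) _   =
  (λ eq → ℕP.m+1+n≢0 n (ℤP.+-injective eq)) , refl
trit-+-double -[1+ n ] (inj₁ refl)        _   = (λ ()) , refl
trit-+-double -[1+ n ] (inj₂ (inj₁ refl)) _   = (λ ()) , refl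
trit-+-double -[1+ n ] (inj₂ (inj₂ refl)) _   = (λ ()) , refl

weighted : {A : Set} → (A → ℤ) → List A → ℤ
weighted v []       = 0ℤ
weighted v (a ∷ as) = v a ℤ.+ (weighted v as ℤ.+ weighted v as)

Ascending : {A : Set} → (A → A → Set) → List A → Set
Ascending _<_ = AllPairs (λ a b → ¬ b < a)

module Dominance {A : Set} (_<_ : A → A → Set) (<-irrefl : ∀ {a} → ¬ a < a)
                 (v : A → ℤ) (v-trit : ∀ a → Trit (v a)) where

  data Dominated (L : List A) : Set where
    vanishing : (∀ {b} → b ∈ L → v b ≡ 0ℤ) → weighted v L ≡ 0ℤ → Dominated L
    dominated : (a : A) → a ∈ L → v a ≢ 0ℤ → (∀ {b} → b ∈ L → a < b → v b ≡ 0ℤ) →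
                weighted v L ≢ 0ℤ → sgn (weighted v L) ≡ sgn (v a) → Dominated L

  weighted-head : ∀ t L → weighted v L ≡ 0ℤ → weighted v (t ∷ L) ≡ v t
  weighted-head t L w≡0 =
    trans (cong (λ w → v t ℤ.+ (w ℤ.+ w)) w≡0) (ℤP.+-identityʳ (v t))

  extend : ∀ t {L} → All (λ b → ¬ b < t) L → Dominated L → Dominated (t ∷ L)
  extend t {L} t-low (vanishing v≡0 w≡0) with v t ℤ.≟ 0ℤ
  ... | yes vt≡0 = vanishing (λ { (here refl) → vt≡0 ; (there b∈L) → v≡0 b∈L })
                             (trans (weighted-head t L w≡0) vt≡0)
  ... | no  vt≢0 =
    dominated t (here refl) vt≢0
      (λ { (here refl) t<t → ⊥-elim (<-irrefl t<t) ; (there b∈L) _ → v≡0 b∈L })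
      (vt≢0 ∘ trans (sym (weighted-head t L w≡0)))
      (cong sgn (weighted-head t L w≡0))
  extend t {L} t-low (dominated a a∈L va≢0 above-a w≢0 sgn-w) =
    dominated a (there a∈L) va≢0 above-a′ (proj₁ doubled) (trans (proj₂ doubled) sgn-w)
    where
      doubled : weighted v (t ∷ L) ≢ 0ℤ × sgn (weighted v (t ∷ L)) ≡ sgn (weighted v L)
      doubled = trit-+-double (weighted v L) (v-trit t) w≢0
      above-a′ : ∀ {b} → b ∈ t ∷ L → a < b → v b ≡ 0ℤ
      above-a′ (here refl) a<t = ⊥-elim (All.lookup t-low a∈L a<t)
      above-a′ (there b∈L)     = above-a b∈L

  dominance : ∀ L → Ascending _<_ L → Dominated L
  dominance []      []            = vanishing (λ ()) refl
  dominance (t ∷ L) (t-low ∷ asc) = extend t t-low (dominance L asc)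

-- The order on K is a strict total order with respect to pointwise equality
-- (K consists of functions, so pointwise equality is the right equality).
module OrderOnK (d : ℕ) (k : Fin d → ℕ) where

  _≈_ : Rel (K d k) 0ℓ
  α ≈ β = ∀ i → α i ≡ β i

  _<_ : Rel (K d k) 0ℓ
  _<_ = _<K_ d k

  ≈-isEquivalence : IsEquivalence _≈_
  ≈-isEquivalence = record
    { refl  = λ _ → refl
    ; sym   = λ α≈β i → sym (α≈β i)
    ; trans = λ α≈β β≈γ i → trans (α≈β i) (β≈γ i)
    }

  AgreeBelow : K d k → K d k → ℕ → Set
  AgreeBelow α β l = ∀ (m : Fin d) → toℕ m ℕ.< l → α m ≡ β m

  coord-agree : ∀ α β l → AgreeBelow α β (suc l) → coord d k α l ≡ coord d k β l
  coord-agree α β l agree with l <? d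
  ... | yes l<d = cong (λ j → suc (toℕ j) , k (fromℕ< l<d))
                       (agree (fromℕ< l<d) (ℕ.s≤s (ℕP.≤-reflexive (FinP.toℕ-fromℕ< l<d))))
  ... | no  _   = refl

  -- The orientation i_l(α) depends only on the coordinates α_m with m < l;
  -- this is what makes the lexicographic-type comparison coherent.
  ind-agree : ∀ α β l → AgreeBelow α β l → ind d k α l ≡ ind d k β l
  ind-agree α β zero    agree = refl
  ind-agree α β (suc l) agree =
    cong₂ (λ b c → parity d k (num d k b c))
          (ind-agree α β l (λ m m<l → agree m (ℕP.m<n⇒m<1+n m<l)))
          (coord-agree α β l agree)

  precedes-irrefl : ∀ {n} b (x : Fin n) → ¬ Precedes d k b x x
  precedes-irrefl true  x = ℕP.<-irrefl refl
  precedes-irrefl false x = ℕP.<-irrefl refl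

  precedes-trans : ∀ {n} b {x y w : Fin n} →
                   Precedes d k b x y → Precedes d k b y w → Precedes d k b x w
  precedes-trans true  x<y y<w = ℕP.<-trans x<y y<w
  precedes-trans false y<x w<y = ℕP.<-trans w<y y<x

  precedes-connex : ∀ {n} b (x y : Fin n) → x ≢ y →
                    Precedes d k b x y ⊎ Precedes d k b y x
  precedes-connex b x y x≢y with ℕP.<-cmp (toℕ x) (toℕ y)
  precedes-connex true  x y x≢y | tri< x<y _ _ = inj₁ x<y
  precedes-connex false x y x≢y | tri< x<y _ _ = inj₂ x<y
  precedes-connex b     x y x≢y | tri≈ _ x≡y _ = ⊥-elim (x≢y (FinP.toℕ-injective x≡y))
  precedes-connex true  x y x≢y | tri> _ _ y<x = inj₂ y<x
  precedes-connex false x y x≢y | tri> _ _ y<x = inj₁ y<x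

  <-irrefl : Irreflexive _≈_ _<_
  <-irrefl α≈β (l , _ , α≺β) =
    precedes-irrefl _ _ (subst (Precedes d k _ _) (sym (α≈β l)) α≺β)

  -- The order respects pointwise equality on both sides; on the left this
  -- needs that equal points have equal orientations.
  <-respʳ-≈ : _<_ Respectsʳ _≈_
  <-respʳ-≈ β≈β′ (l , agree , α≺β) =
    l , (λ m m<l → trans (agree m m<l) (β≈β′ m)) , subst (Precedes d k _ _) (β≈β′ l) α≺β

  <-respˡ-≈ : _<_ Respectsˡ _≈_
  <-respˡ-≈ {γ} {α} {α′} α≈α′ (l , agree , α≺γ) =
    l , (λ m m<l → trans (sym (α≈α′ m)) (agree m m<l)) ,
    subst₂ (λ b x → Precedes d k b x (γ l))
           (ind-agree α α′ (toℕ l) (λ m _ → α≈α′ m)) (α≈α′ l) α≺γ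

  -- Compare at the smaller of the two first-difference indices.
  <-trans : Transitive _<_
  <-trans {α} {β} {γ} (l₁ , agree₁ , α≺β) (l₂ , agree₂ , β≺γ)
    with ℕP.<-cmp (toℕ l₁) (toℕ l₂)
  ... | tri< l₁<l₂ _ _ =
    l₁ , (λ m m<l → trans (agree₁ m m<l) (agree₂ m (ℕP.<-trans m<l l₁<l₂))) ,
    subst (Precedes d k _ _) (agree₂ l₁ l₁<l₂) α≺β
  ... | tri> _ _ l₂<l₁ =
    l₂ , (λ m m<l → trans (agree₁ m (ℕP.<-trans m<l l₂<l₁)) (agree₂ m m<l)) ,
    subst₂ (λ b x → Precedes d k b x (γ l₂))
           (sym (ind-agree α β (toℕ l₂) (λ m m<l → agree₁ m (ℕP.<-trans m<l l₂<l₁))))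
           (sym (agree₁ l₂ l₂<l₁)) β≺γ
  ... | tri≈ _ l₁≡l₂ _ with FinP.toℕ-injective {i = l₁} {j = l₂} l₁≡l₂
  ...   | refl =
    l₁ , (λ m m<l → trans (agree₁ m m<l) (agree₂ m m<l)) ,
    precedes-trans _ α≺β (subst (λ b → Precedes d k b (β l₁) (γ l₁))
                                (sym (ind-agree α β (toℕ l₁) agree₁)) β≺γ)

  firstDifference : ∀ α β n → n ≤ d →
    AgreeBelow α β n ⊎ Σ (Fin d) λ l → AgreeBelow α β (toℕ l) × α l ≢ β l
  firstDifference α β zero    _   = inj₁ (λ m ())
  firstDifference α β (suc n) n<d with firstDifference α β n (ℕP.<⇒≤ n<d)
  ... | inj₂ difference = inj₂ difference
  ... | inj₁ agree with α (fromℕ< n<d) Fin.≟ β (fromℕ< n<d)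
  ...   | no  differ = inj₂ (fromℕ< n<d , agree′ , differ)
    where
      agree′ : AgreeBelow α β (toℕ (fromℕ< n<d))
      agree′ m m<l = agree m (subst (toℕ m ℕ.<_) (FinP.toℕ-fromℕ< n<d) m<l)
  ...   | yes same = inj₁ agree′
    where
      agree′ : AgreeBelow α β (suc n)
      agree′ m m<1+n with ℕP.m<1+n⇒m<n∨m≡n m<1+n
      ... | inj₁ m<n = agree m m<n
      ... | inj₂ m≡n
        rewrite FinP.toℕ-injective {i = m} {j = fromℕ< n<d}
                                   (trans m≡n (sym (FinP.toℕ-fromℕ< n<d))) = same

  compare : Trichotomous _≈_ _<_
  compare α β with firstDifference α β d ℕP.≤-refl
  ... | inj₁ agree = tri≈ (<-irrefl α≈β) α≈β (<-irrefl (λ i → sym (α≈β i)))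
    where
      α≈β : α ≈ β
      α≈β i = agree i (FinP.toℕ<n i)
  ... | inj₂ (l , agree , differ) with precedes-connex (ind d k α (toℕ l)) (α l) (β l) differ
  ...   | inj₁ α≺β = tri< (l , agree , α≺β) (λ α≈β → <-irrefl α≈β (l , agree , α≺β))
                          (λ β<α → <-irrefl (λ _ → refl) (<-trans (l , agree , α≺β) β<α))
  ...   | inj₂ β≺α = tri> (λ α<β → <-irrefl (λ _ → refl) (<-trans α<β β>α))
                          (λ α≈β → <-irrefl (λ i → sym (α≈β i)) β>α) β>α
    where
      β>α : β < α
      β>α = l , (λ m m<l → sym (agree m m<l)) ,
            subst (λ b → Precedes d k b (β l) (α l)) (ind-agree α β (toℕ l) agree) β≺α

  -- The bundled strict total order, from which the library derives a sort.
  strictTotalOrder : StrictTotalOrder 0ℓ 0ℓ 0ℓ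
  strictTotalOrder = record
    { isStrictTotalOrder = record
      { isStrictPartialOrder = record
        { isEquivalence = ≈-isEquivalence
        ; irrefl        = <-irrefl
        ; trans         = <-trans
        ; <-resp-≈      = <-respʳ-≈ , <-respˡ-≈
        }
      ; compare = compare
      }
    }

consK : ∀ {n} {k : Fin (suc n) → ℕ} → Fin (k Fin.zero) → K n (k ∘ Fin.suc) → K (suc n) k
consK j α Fin.zero    = j
consK j α (Fin.suc i) = α i

enumK : (n : ℕ) (k : Fin n → ℕ) → List (K n k)
enumK zero    k = (λ ()) ∷ []
enumK (suc n) k =
  concatMap (λ j → map (consK j) (enumK n (k ∘ Fin.suc))) (allFin (k Fin.zero))

enumK-complete : ∀ n k (α : K n k) →
                 Σ (K n k) λ β → β ∈ enumK n k × (∀ i → α i ≡ β i)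
enumK-complete zero    k α = (λ ()) , here refl , (λ ())
enumK-complete (suc n) k α with enumK-complete n (k ∘ Fin.suc) (α ∘ Fin.suc)
... | β , β∈enum , α≈β =
  consK (α Fin.zero) β ,
  ∈-concatMap⁺ (λ j → map (consK j) (enumK n (k ∘ Fin.suc)))
    (Any.map (λ { refl → ∈-map⁺ (consK (α Fin.zero)) β∈enum }) (∈-allFin (α Fin.zero))) ,
  λ { Fin.zero → refl ; (Fin.suc i) → α≈β i }

module Expansion {V : Set} where

  eval-++ : ∀ (P Q : Poly V) z → eval (P ++ Q) z ≡ eval P z ℤ.+ eval Q z
  eval-++ []      Q z = sym (ℤP.+-identityˡ (eval Q z))
  eval-++ (t ∷ P) Q z =
    trans (cong (ℤ._+_ (coeff t ℤ.* evalMono z (mono t))) (eval-++ P Q z))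
          (sym (ℤP.+-assoc (coeff t ℤ.* evalMono z (mono t)) (eval P z) (eval Q z)))

  scaleVar : ℤ → V → Term V → Term V
  scaleVar c x t = term (c ℤ.* coeff t) (x ∷ mono t)

  eval-scaleVar : ∀ c x (P : Poly V) z →
                  eval (map (scaleVar c x) P) z ≡ c ℤ.* val (z x) ℤ.* eval P z
  eval-scaleVar c x []      z = sym (ℤP.*-zeroʳ (c ℤ.* val (z x)))
  eval-scaleVar c x (t ∷ P) z =
    trans (cong (ℤ._+_ (c ℤ.* coeff t ℤ.* (val (z x) ℤ.* evalMono z (mono t))))
                (eval-scaleVar c x P z))
          (distrib c (coeff t) (val (z x)) (evalMono z (mono t)) (eval P z))
    where
      distrib : ∀ c a v e r → c ℤ.* a ℤ.* (v ℤ.* e) ℤ.+ c ℤ.* v ℤ.* r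
                              ≡ c ℤ.* v ℤ.* (a ℤ.* e ℤ.+ r)
      distrib = solve-∀

  mulDiff : V → V → Poly V → Poly V
  mulDiff x y P = map (scaleVar 1ℤ x) P ++ map (scaleVar -1ℤ y) P

  eval-mulDiff : ∀ x y P z →
                 eval (mulDiff x y P) z ≡ (val (z x) ℤ.- val (z y)) ℤ.* eval P z
  eval-mulDiff x y P z = begin
    eval (mulDiff x y P) z
      ≡⟨ eval-++ (map (scaleVar 1ℤ x) P) (map (scaleVar -1ℤ y) P) z ⟩
    eval (map (scaleVar 1ℤ x) P) z ℤ.+ eval (map (scaleVar -1ℤ y) P) z
      ≡⟨ cong₂ ℤ._+_ (eval-scaleVar 1ℤ x P z) (eval-scaleVar -1ℤ y P z) ⟩
    1ℤ ℤ.* val (z x) ℤ.* eval P z ℤ.+ -1ℤ ℤ.* val (z y) ℤ.* eval P z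
      ≡⟨ factor (val (z x)) (val (z y)) (eval P z) ⟩
    (val (z x) ℤ.- val (z y)) ℤ.* eval P z ∎
    where
      open ≡-Reasoning
      factor : ∀ a b e → 1ℤ ℤ.* a ℤ.* e ℤ.+ -1ℤ ℤ.* b ℤ.* e ≡ (a ℤ.- b) ℤ.* e
      factor = solve-∀

  mulDiff-degree : ∀ {n} x y P → DegLe P n → DegLe (mulDiff x y P) (suc n)
  mulDiff-degree x y P deg =
    AllP.++⁺ (AllP.map⁺ (All.map ℕ.s≤s deg)) (AllP.map⁺ (All.map ℕ.s≤s deg))

module Construction (d : ℕ) (k : Fin d → ℕ) where

  open OrderOnK d k
  open Expansion
  open import Relation.Binary.Properties.StrictTotalOrder strictTotalOrder
    using (decTotalOrder) renaming (trans to ≤-trans)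
  open import Data.List.Sort decTotalOrder using (sort; sort-↭; sort-↗)

  prodFin-trit : ∀ n g → (∀ i → Trit (g i)) → Trit (prodFin d k n g)
  prodFin-trit zero    g g-trit = inj₂ (inj₁ refl)
  prodFin-trit (suc n) g g-trit =
    trit-* (g-trit Fin.zero) (prodFin-trit n (g ∘ Fin.suc) (g-trit ∘ Fin.suc))

  prodFin-cong : ∀ n {g h} → (∀ i → g i ≡ h i) → prodFin d k n g ≡ prodFin d k n h
  prodFin-cong zero    g≗h = refl
  prodFin-cong (suc n) g≗h = cong₂ ℤ._*_ (g≗h Fin.zero) (prodFin-cong n (g≗h ∘ Fin.suc))

  prodα-trit : ∀ z α → Trit (prodα d k z α)
  prodα-trit z α =
    prodFin-trit d _ (λ i → bitDiff-trit (z (true , i , α i)) (z (false , i , α i)))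

  prodα-cong : ∀ z {α β} → α ≈ β → prodα d k z α ≡ prodα d k z β
  prodα-cong z α≈β =
    prodFin-cong d (λ i → cong (λ j → val (z (true , i , j)) ℤ.- val (z (false , i , j))) (α≈β i))

  productOfDiffs : ∀ n → (Fin n → Var d k × Var d k) → Poly (Var d k)
  productOfDiffs zero    h = term 1ℤ [] ∷ []
  productOfDiffs (suc n) h =
    mulDiff (proj₁ (h Fin.zero)) (proj₂ (h Fin.zero)) (productOfDiffs n (h ∘ Fin.suc))

  productOfDiffs-degree : ∀ n h → DegLe (productOfDiffs n h) n
  productOfDiffs-degree zero    h = ℕ.z≤n ∷ []
  productOfDiffs-degree (suc n) h =
    mulDiff-degree _ _ (productOfDiffs n (h ∘ Fin.suc)) (productOfDiffs-degree n (h ∘ Fin.suc))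

  eval-productOfDiffs : ∀ n h z → eval (productOfDiffs n h) z
                        ≡ prodFin d k n (λ i → val (z (proj₁ (h i))) ℤ.- val (z (proj₂ (h i))))
  eval-productOfDiffs zero    h z = refl
  eval-productOfDiffs (suc n) h z =
    trans (eval-mulDiff (proj₁ (h Fin.zero)) (proj₂ (h Fin.zero)) (productOfDiffs n (h ∘ Fin.suc)) z)
          (cong (ℤ._*_ (val (z (proj₁ (h Fin.zero))) ℤ.- val (z (proj₂ (h Fin.zero)))))
                (eval-productOfDiffs n (h ∘ Fin.suc) z))

  factors : K d k → Fin d → Var d k × Var d k
  factors α i = (true , i , α i) , (false , i , α i)

  hornerPoly : List (K d k) → Poly (Var d k)
  hornerPoly []      = []
  hornerPoly (α ∷ L) = productOfDiffs d (factors α) ++ (hornerPoly L ++ hornerPoly L)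

  hornerPoly-degree : ∀ L → DegLe (hornerPoly L) d
  hornerPoly-degree []      = []
  hornerPoly-degree (α ∷ L) =
    AllP.++⁺ (productOfDiffs-degree d (factors α))
             (AllP.++⁺ (hornerPoly-degree L) (hornerPoly-degree L))

  eval-hornerPoly : ∀ z L → eval (hornerPoly L) z ≡ weighted (prodα d k z) L
  eval-hornerPoly z []      = refl
  eval-hornerPoly z (α ∷ L) = begin
    eval (productOfDiffs d (factors α) ++ (hornerPoly L ++ hornerPoly L)) z
      ≡⟨ eval-++ (productOfDiffs d (factors α)) (hornerPoly L ++ hornerPoly L) z ⟩
    eval (productOfDiffs d (factors α)) z ℤ.+ eval (hornerPoly L ++ hornerPoly L) z
      ≡⟨ cong₂ ℤ._+_ (eval-productOfDiffs d (factors α) z) (eval-++ (hornerPoly L) (hornerPoly L) z) ⟩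
    prodα d k z α ℤ.+ (eval (hornerPoly L) z ℤ.+ eval (hornerPoly L) z)
      ≡⟨ cong (λ w → prodα d k z α ℤ.+ (w ℤ.+ w)) (eval-hornerPoly z L) ⟩
    weighted (prodα d k z) (α ∷ L) ∎
    where open ≡-Reasoning

  ascendingK : List (K d k)
  ascendingK = sort (enumK d k)

  -- A list sorted for the non-strict order ≤ = (< or ≈) is ascending, since
  -- transitivity upgrades adjacent comparisons to all pairs.
  ascendingK-ascending : Ascending _<_ ascendingK
  ascendingK-ascending = AllPairs.map ≤⇒≯ (Linked⇒AllPairs ≤-trans (sort-↗ (enumK d k)))
    where
      ≤⇒≯ : ∀ {α β} → α < β ⊎ α ≈ β → ¬ β < α
      ≤⇒≯ (inj₁ α<β) β<α = <-irrefl (λ _ → refl) (<-trans α<β β<α)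
      ≤⇒≯ (inj₂ α≈β) β<α = <-irrefl (λ i → sym (α≈β i)) β<α

  -- Sorting permutes the enumeration, so every α still occurs up to ≈.
  ascendingK-complete : ∀ α → Σ (K d k) λ β → β ∈ ascendingK × α ≈ β
  ascendingK-complete α with enumK-complete d k α
  ... | β , β∈enum , α≈β = β , ∈-resp-↭ (↭-sym (sort-↭ (enumK d k))) β∈enum , α≈β

  thresholdPoly : Poly (Var d k)
  thresholdPoly = hornerPoly ascendingK

  thresholdPoly-correct : ∀ z → FValue d k z (sgn (eval thresholdPoly z))
  thresholdPoly-correct z
    with Dominance.dominance _<_ (<-irrefl (λ _ → refl)) (prodα d k z) (prodα-trit z)
                             ascendingK ascendingK-ascending
  ... | Dominance.vanishing v≡0 w≡0 =
    inj₂ (vanishes , cong sgn (trans (eval-hornerPoly z ascendingK) w≡0))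
    where
      vanishes : ∀ α → prodα d k z α ≡ 0ℤ
      vanishes α with ascendingK-complete α
      ... | β , β∈L , α≈β = trans (prodα-cong z α≈β) (v≡0 β∈L)
  ... | Dominance.dominated a _ va≢0 above-a _ sgn-w =
    inj₁ (a , va≢0 , above-a′ , trans (cong sgn (eval-hornerPoly z ascendingK)) sgn-w)
    where
      above-a′ : ∀ β → a < β → prodα d k z β ≡ 0ℤ
      above-a′ β a<β with ascendingK-complete β
      ... | β′ , β′∈L , β≈β′ = trans (prodα-cong z β≈β′) (above-a β′∈L (<-respʳ-≈ β≈β′ a<β))

lemma3p1 : (d : ℕ) → d ≥ 1 → (k : Fin d → ℕ) → (∀ i → k i ≥ 1) →
    Σ (Poly (Var d k)) (λ p → DegLe p d × (∀ z → FValue d k z (sgn (eval p z))))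
lemma3p1 d _ k _ = thresholdPoly , hornerPoly-degree ascendingK , thresholdPoly-correct
  where open Construction d k
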